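{- Let $\mathsf L\in\{\mathsf N_\preccurlyeq,\mathsf{NN}_\preccurlyeq,\mathsf{NT}_\preccurlyeq,\mathsf{NW}_\preccurlyeq,\mathsf{NC}_\preccurlyeq,\mathsf{NA}_\preccurlyeq,\mathsf{NNA}_\preccurlyeq\}$ and let $\mathsf{G.L}$ be the corresponding sequent calculus. If the sequent $\Gamma\Rightarrow\Delta$ is derivable in $\mathsf{G.L}$, then $\bigwedge\Gamma\to\bigvee\Delta$ is derivable in $\mathsf L$.
   Context: Language: formulas $A ::= p \mid \bot \mid A\to A \mid A \preccurlyeq A$ over countably many atoms; $\top,\neg,\wedge,\vee$ defined as usual. Hilbert systems: axioms/rules (cpr) from $A\to B$ infer $B\preccurlyeq A$; (tr) $(A\preccurlyeq B)\wedge(B\preccurlyeq C)\to(A\preccurlyeq C)$; (or) $(A\preccurlyeq B)\wedge(A\preccurlyeq C)\to(A\preccurlyeq B\vee C)$; (n) $\neg(\bot\preccurlyeq\top)$; (t) $(\bot\preccurlyeq A)\to\neg A$; (w) $A\to(A\preccurlyeq\top)$; (c) $(A\preccurlyeq\top)\to A$; (a$-$) $(A\preccurlyeq B)\to(\bot\preccurlyeq\neg(A\preccurlyeq B))$; (a) $\neg(A\preccurlyeq B)\to(\bot\preccurlyeq(A\preccurlyeq B))$. $\mathsf N_\preccurlyeq$ = classical propositional logic plus tr, or, cpr; $\mathsf{NN}_\preccurlyeq=\mathsf N_\preccurlyeq+$n; $\mathsf{NT}_\preccurlyeq=\mathsf N_\preccurlyeq+$t; $\mathsf{NW}_\preccurlyeq=\mathsf{NT}_\preccurlyeq+$w;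 $\mathsf{NC}_\preccurlyeq=\mathsf{NW}_\preccurlyeq+$c; $\mathsf{NA}_\preccurlyeq=\mathsf N_\preccurlyeq+$a$-$,a; $\mathsf{NNA}_\preccurlyeq=\mathsf{NN}_\preccurlyeq+$a$-$,a. Derivability: finite sequence of axioms, modus ponens and cpr applications. Sequents $\Gamma\Rightarrow\Delta$: $\Gamma,\Delta$ finite multisets of formulas, read as $\bigwedge\Gamma\to\bigvee\Delta$. Rules (write $\Sigma^{\preccurlyeq}$ for $C_1\preccurlyeq D_1,\dots,C_n\preccurlyeq D_n$; $\Gamma^{\preccurlyeq}$, $\Delta^{\preccurlyeq}$ for the $\preccurlyeq$-formulas in $\Gamma$, $\Delta$): init: $\Gamma,p\Rightarrow p,\Delta$; $\bot_L$: $\Gamma,\bot\Rightarrow\Delta$; $\to_L$: from $\Gamma\Rightarrow A,\Delta$ and $\Gamma,B\Rightarrow\Delta$ infer $\Gamma,A\to B\Rightarrow\Delta$; $\to_R$: from $\Gamma,A\Rightarrow B,\Delta$ infer $\Gamma\Rightarrow A\to B,\Delta$. $\mathrm{CP}_n$: from $\{C_k\Rightarrow A,D_1,\dots,D_{k-1}\}_{1\le k\le n}$ and $B\Rightarrow A,D_1,\dots,D_n$ infer $\Gamma,\Sigma^{\preccurlyeq}\Rightarrow A\preccurlyeq B,\Delta$. $\mathrm N_n$: from $\{C_k\Rightarrow D_1,\dots,D_{k-1}\}_{k\le n}$ and $\Rightarrow D_1,\dots,D_n$ infer $\Gamma,\Sigma^{\preccurlyeq}\Rightarrow\Delta$. $\mathrm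 T_n$: from $\{C_k\Rightarrow D_1,\dots,D_{k-1}\}_{k\le n}$ and $\Gamma,\Sigma^{\preccurlyeq}\Rightarrow D_1,\dots,D_n,\Delta$ infer $\Gamma,\Sigma^{\preccurlyeq}\Rightarrow\Delta$. $\mathrm W_n$: from $\{C_k\Rightarrow A,D_1,\dots,D_{k-1}\}_{k\le n}$ and $\Gamma,\Sigma^{\preccurlyeq}\Rightarrow A,A\preccurlyeq B,D_1,\dots,D_n,\Delta$ infer $\Gamma,\Sigma^{\preccurlyeq}\Rightarrow A\preccurlyeq B,\Delta$. $\mathrm W_0$: from $\Gamma\Rightarrow A\preccurlyeq B,A,\Delta$ infer $\Gamma\Rightarrow A\preccurlyeq B,\Delta$. $\mathrm C_0$: from $\Gamma,A\preccurlyeq B,A\Rightarrow\Delta$ and $\Gamma,A\preccurlyeq B\Rightarrow B,\Delta$ infer $\Gamma,A\preccurlyeq B\Rightarrow\Delta$. $\mathrm A_n$: from $\{\Gamma^{\preccurlyeq},\Sigma^{\preccurlyeq},C_k\Rightarrow A\preccurlyeq B,A,D_1,\dots,D_{k-1},\Delta^{\preccurlyeq}\}_{k\le n}$ and $\Gamma^{\preccurlyeq},\Sigma^{\preccurlyeq},B\Rightarrow A\preccurlyeq B,A,D_1,\dots,D_n,\Delta^{\preccurlyeq}$ infer $\Gamma,\Sigma^{\preccurlyeq}\Rightarrow A\preccurlyeq B,\Delta$. $\mathrm N^A_n$: from $\{\Gamma^{\preccurlyeq},\Sigma^{\preccurlyeq},C_k\Rightarrow D_1,\dots,D_{k-1},\Delta^{\preccurlyeq}\}_{k\le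 n}$ and $\Gamma^{\preccurlyeq},\Sigma^{\preccurlyeq}\Rightarrow D_1,\dots,D_n,\Delta^{\preccurlyeq}$ infer $\Gamma,\Sigma^{\preccurlyeq}\Rightarrow\Delta$. Calculi: $\mathsf{G.N}=\{\mathrm{init},\bot_L,\to_L,\to_R\}\cup\{\mathrm{CP}_n\mid n\ge0\}$; $\mathsf{G.NN}=\mathsf{G.N}\cup\{\mathrm N_n\mid n\ge1\}$; $\mathsf{G.NT}=\mathsf{G.N}\cup\{\mathrm T_n\mid n\ge1\}$; $\mathsf{G.NW}=\mathsf{G.N}\cup\{\mathrm W_n\mid n\ge0\}\cup\{\mathrm T_n\mid n\ge1\}$; $\mathsf{G.NC}=\mathsf{G.N}\cup\{\mathrm W_0,\mathrm C_0\}$; $\mathsf{G.NA}=\{\mathrm{init},\bot_L,\to_L,\to_R\}\cup\{\mathrm A_n\mid n\ge0\}$; $\mathsf{G.NNA}=\mathsf{G.NA}\cup\{\mathrm N^A_n\mid n\ge1\}$. The calculus corresponding to $\mathsf N X_\preccurlyeq$ is $\mathsf{G.N}X$. -}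

module Defs where

open import Data.Nat using (ℕ; zero; suc; _≤_)
open import Data.Fin using (Fin; zero; suc)
open import Data.List using (List; []; _∷_; _++_; map; tabulate)
open import Data.Bool using (Bool; true; false; T)
open import Data.List.Relation.Binary.Permutation.Propositional using (_↭_)

infixr 6 _⇒_
infix 7 _≼_

data Fm : Set where
  atom : ℕ → Fm
  ⊥'   : Fm
  _⇒_  : Fm → Fm → Fm
  _≼_  : Fm → Fm → Fm

¬' : Fm → Fm
¬' A = A ⇒ ⊥'

⊤' : Fm
⊤' = ¬' ⊥'

_∧'_ : Fm → Fm → Fm
A ∧' B = ¬' (A ⇒ ¬' B)

_∨'_ : Fm → Fm → Fm
A ∨' B = ¬' A ⇒ B

⋀ : List Fm → Fm
⋀ []       = ⊤'
⋀ (A ∷ Γ) = A ∧' ⋀ Γ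

⋁ : List Fm → Fm
⋁ []       = ⊥'
⋁ (A ∷ Δ) = A ∨' ⋁ Δ

data Logic : Set where
  N NN NT NW NC NA NNA : Logic

has-n : Logic → Bool
has-n NN  = true
has-n NNA = true
has-n _   = false

has-t : Logic → Bool
has-t NT = true
has-t NW = true
has-t NC = true
has-t _  = false

has-w : Logic → Bool
has-w NW = true
has-w NC = true
has-w _  = false

has-c : Logic → Bool
has-c NC = true
has-c _  = false

has-a : Logic → Bool
has-a NA  = true
has-a NNA = true
has-a _   = false

-- Hilbert systems.  Classical propositional logic in the language {⊥,→}
-- is axiomatised by K, S and double negation elimination with modus ponens.

infix 3 _⊢H_

data _⊢H_ (L : Logic) : Fm → Set where
  ax-K  : ∀ A B → L ⊢H A ⇒ (B ⇒ A)
  ax-S  : ∀ A B C → L ⊢H (A ⇒ (B ⇒ C)) ⇒ ((A ⇒ B) ⇒ (A ⇒ C))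
  ax-DN : ∀ A → L ⊢H ¬' (¬' A) ⇒ A
  mp    : ∀ {A B} → L ⊢H A ⇒ B → L ⊢H A → L ⊢H B
  cpr   : ∀ {A B} → L ⊢H A ⇒ B → L ⊢H B ≼ A
  ax-tr : ∀ A B C → L ⊢H ((A ≼ B) ∧' (B ≼ C)) ⇒ (A ≼ C)
  ax-or : ∀ A B C → L ⊢H ((A ≼ B) ∧' (A ≼ C)) ⇒ (A ≼ (B ∨' C))
  ax-n  : T (has-n L) → L ⊢H ¬' (⊥' ≼ ⊤')
  ax-t  : T (has-t L) → ∀ A → L ⊢H (⊥' ≼ A) ⇒ ¬' A
  ax-w  : T (has-w L) → ∀ A → L ⊢H A ⇒ (A ≼ ⊤')
  ax-c  : T (has-c L) → ∀ A → L ⊢H (A ≼ ⊤') ⇒ A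
  ax-a- : T (has-a L) → ∀ A B → L ⊢H (A ≼ B) ⇒ (⊥' ≼ ¬' (A ≼ B))
  ax-a  : T (has-a L) → ∀ A B → L ⊢H ¬' (A ≼ B) ⇒ (⊥' ≼ (A ≼ B))

rule-CP : Logic → Bool
rule-CP NA  = false
rule-CP NNA = false
rule-CP _   = true

rule-N : Logic → Bool
rule-N NN = true
rule-N _  = false

rule-T : Logic → Bool
rule-T NT = true
rule-T NW = true
rule-T _  = false

rule-W : Logic → Bool
rule-W NW = true
rule-W _  = false

rule-WC0 : Logic → Bool
rule-WC0 NC = true
rule-WC0 _  = false

rule-A : Logic → Bool
rule-A NA  = true
rule-A NNA = true
rule-A _   = false

rule-NA : Logic → Bool
rule-NA NNA = true
rule-NA _   = false

-- Helpers for the rules with Σ^≼ = C₁≼D₁,…,Cₙ≼Dₙ  (C D : Fin n → Fm)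

-- D₁,…,D_{k-1}  for the k-th index (0-based: D 0,…,D (k-1))
below : ∀ {n} → (Fin n → Fm) → Fin n → List Fm
below D zero    = []
below D (suc k) = D zero ∷ below (λ i → D (suc i)) k

allD : ∀ {n} → (Fin n → Fm) → List Fm
allD D = tabulate D

Σ≼ : ∀ {n} → (Fin n → Fm) → (Fin n → Fm) → List Fm
Σ≼ C D = tabulate (λ i → C i ≼ D i)

prefs : List Fm → List Fm
prefs []            = []
prefs (atom p ∷ Γ)  = prefs Γ
prefs (⊥' ∷ Γ)      = prefs Γ
prefs (A ⇒ B ∷ Γ)   = prefs Γ
prefs (A ≼ B ∷ Γ)   = A ≼ B ∷ prefs Γ

-- Sequent calculi G.L.  Sequents are pairs of lists, read as multisets:
-- every rule's conclusion may be any permutation of the displayed one.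

infix 3 _⊢G_⟹_

data _⊢G_⟹_ (L : Logic) : List Fm → List Fm → Set where
  init : ∀ {Γ' Δ'} Γ Δ p → Γ' ↭ atom p ∷ Γ → Δ' ↭ atom p ∷ Δ →
         L ⊢G Γ' ⟹ Δ'
  ⊥L   : ∀ {Γ' Δ'} Γ → Γ' ↭ ⊥' ∷ Γ → L ⊢G Γ' ⟹ Δ'
  ⇒L   : ∀ {Γ' Δ} Γ A B → Γ' ↭ (A ⇒ B) ∷ Γ →
         L ⊢G Γ ⟹ A ∷ Δ → L ⊢G B ∷ Γ ⟹ Δ → L ⊢G Γ' ⟹ Δ
  ⇒R   : ∀ {Γ Δ'} Δ A B → Δ' ↭ (A ⇒ B) ∷ Δ →
         L ⊢G A ∷ Γ ⟹ B ∷ Δ → L ⊢G Γ ⟹ Δ'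
  CP   : T (rule-CP L) → ∀ {Γ' Δ'} Γ Δ A B n (C D : Fin n → Fm) →
         Γ' ↭ Σ≼ C D ++ Γ → Δ' ↭ (A ≼ B) ∷ Δ →
         (∀ k → L ⊢G C k ∷ [] ⟹ A ∷ below D k) →
         L ⊢G B ∷ [] ⟹ A ∷ allD D →
         L ⊢G Γ' ⟹ Δ'
  Nn   : T (rule-N L) → ∀ {Γ' Δ} Γ n (C D : Fin n → Fm) → 1 ≤ n →
         Γ' ↭ Σ≼ C D ++ Γ →
         (∀ k → L ⊢G C k ∷ [] ⟹ below D k) →
         L ⊢G [] ⟹ allD D →
         L ⊢G Γ' ⟹ Δ
  Tn   : T (rule-T L) → ∀ {Γ' Δ} Γ n (C D : Fin n → Fm) → 1 ≤ n →
         Γ' ↭ Σ≼ C D ++ Γ →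
         (∀ k → L ⊢G C k ∷ [] ⟹ below D k) →
         L ⊢G Σ≼ C D ++ Γ ⟹ allD D ++ Δ →
         L ⊢G Γ' ⟹ Δ
  Wn   : T (rule-W L) → ∀ {Γ' Δ'} Γ Δ A B n (C D : Fin n → Fm) →
         Γ' ↭ Σ≼ C D ++ Γ → Δ' ↭ (A ≼ B) ∷ Δ →
         (∀ k → L ⊢G C k ∷ [] ⟹ A ∷ below D k) →
         L ⊢G Σ≼ C D ++ Γ ⟹ A ∷ (A ≼ B) ∷ allD D ++ Δ →
         L ⊢G Γ' ⟹ Δ'
  W0   : T (rule-WC0 L) → ∀ {Γ Δ'} Δ A B → Δ' ↭ (A ≼ B) ∷ Δ →
         L ⊢G Γ ⟹ (A ≼ B) ∷ A ∷ Δ →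
         L ⊢G Γ ⟹ Δ'
  C0   : T (rule-WC0 L) → ∀ {Γ' Δ} Γ A B → Γ' ↭ (A ≼ B) ∷ Γ →
         L ⊢G (A ≼ B) ∷ A ∷ Γ ⟹ Δ →
         L ⊢G (A ≼ B) ∷ Γ ⟹ B ∷ Δ →
         L ⊢G Γ' ⟹ Δ
  An   : T (rule-A L) → ∀ {Γ' Δ'} Γ Δ A B n (C D : Fin n → Fm) →
         Γ' ↭ Σ≼ C D ++ Γ → Δ' ↭ (A ≼ B) ∷ Δ →
         (∀ k → L ⊢G prefs Γ ++ Σ≼ C D ++ C k ∷ []
                   ⟹ (A ≼ B) ∷ A ∷ below D k ++ prefs Δ) →
         L ⊢G prefs Γ ++ Σ≼ C D ++ B ∷ [] ⟹ (A ≼ B) ∷ A ∷ allD D ++ prefs Δ →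
         L ⊢G Γ' ⟹ Δ'
  NAn  : T (rule-NA L) → ∀ {Γ' Δ} Γ n (C D : Fin n → Fm) → 1 ≤ n →
         Γ' ↭ Σ≼ C D ++ Γ →
         (∀ k → L ⊢G prefs Γ ++ Σ≼ C D ++ C k ∷ [] ⟹ below D k ++ prefs Δ) →
         L ⊢G prefs Γ ++ Σ≼ C D ⟹ allD D ++ prefs Δ →
         L ⊢G Γ' ⟹ Δ

-- Read a sequent Γ ⟹ Δ semantically inside the Hilbert system: it is valid when
-- every set of hypotheses that proves all of Γ and refutes all of Δ is
-- inconsistent.
-- The ≼-rules all reduce to one chain argument: from A₀ ≼ A, the
-- hypotheses Cₖ ≼ Dₖ and the premises Cₖ → A ∨ D₁ ∨ … ∨ Dₖ₋₁ one gets
-- A₀ ≼ A ∨ D₁ ∨ … ∨ Dₙ by cpr, tr and or, and then A₀ ≼ X for every X that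
-- implies that disjunction. In NA and NNA the side ≼-formulas of the context
-- are decided by the axioms a and a−, which lets them be absorbed into the
-- principal formula.
{-# OPTIONS --safe #-}
module Submission where

open import Defs
open import Data.Bool using (T)
open import Data.Nat using (ℕ)
open import Data.Fin using (Fin; zero; suc)
open import Data.List using (List; []; _∷_; _++_; map)
open import Data.List.Properties using (++-assoc; ++-identityʳ)
open import Data.List.Membership.Propositional using (_∈_)
open import Data.List.Membership.Propositional.Properties using (∈-tabulate⁺)
open import Data.List.Relation.Unary.All as All using (All; []; _∷_)
open import Data.List.Relation.Unary.All.Properties
  using (++⁺; ++⁻; ++⁻ˡ; ++⁻ʳ; map⁺; map⁻; tabulate⁺; tabulate⁻)
open import Data.List.Relation.Unary.Any using (here; there)
open import Data.List.Relation.Binary.Permutation.Propositional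
  using (_↭_; ↭-refl; ↭-reflexive; prep)
open import Data.List.Relation.Binary.Permutation.Propositional.Properties
  using (All-resp-↭; ++-comm)
open import Data.Product using (_,_)
open import Relation.Binary.PropositionalEquality using (refl; cong)

rule-N⇒has-n : ∀ L → T (rule-N L) → T (has-n L)
rule-N⇒has-n = λ { NN t → t ; N () ; NT () ; NW () ; NC () ; NA () ; NNA () }

rule-T⇒has-t : ∀ L → T (rule-T L) → T (has-t L)
rule-T⇒has-t = λ { NT t → t ; NW t → t ; N () ; NN () ; NC () ; NA () ; NNA () }

rule-W⇒has-w : ∀ L → T (rule-W L) → T (has-w L)
rule-W⇒has-w = λ { NW t → t ; N () ; NN () ; NT () ; NC () ; NA () ; NNA () }

rule-WC0⇒has-w : ∀ L → T (rule-WC0 L) → T (has-w L)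
rule-WC0⇒has-w = λ { NC t → t ; N () ; NN () ; NT () ; NW () ; NA () ; NNA () }

rule-WC0⇒has-c : ∀ L → T (rule-WC0 L) → T (has-c L)
rule-WC0⇒has-c = λ { NC t → t ; N () ; NN () ; NT () ; NW () ; NA () ; NNA () }

rule-A⇒has-a : ∀ L → T (rule-A L) → T (has-a L)
rule-A⇒has-a = λ { NA t → t ; NNA t → t ; N () ; NN () ; NT () ; NW () ; NC () }

rule-NA⇒has-a : ∀ L → T (rule-NA L) → T (has-a L)
rule-NA⇒has-a = λ { NNA t → t ; N () ; NN () ; NT () ; NW () ; NC () ; NA () }

rule-NA⇒has-n : ∀ L → T (rule-NA L) → T (has-n L)
rule-NA⇒has-n = λ { NNA t → t ; N () ; NN () ; NT () ; NW () ; NC () ; NA () }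

module Derivations (L : Logic) where

  infix 3 _⊢_ _⊢⁺_ _⊢⁻_ _⊩_

  data _⊢_ (H : List Fm) : Fm → Set where
    hyp : ∀ {A} → A ∈ H → H ⊢ A
    thm : ∀ {A} → L ⊢H A → H ⊢ A
    app : ∀ {A B} → H ⊢ A ⇒ B → H ⊢ A → H ⊢ B

  _⊢⁺_ : List Fm → List Fm → Set
  H ⊢⁺ Γ = All (H ⊢_) Γ

  _⊢⁻_ : List Fm → List Fm → Set
  H ⊢⁻ Δ = All (λ A → H ⊢ ¬' A) Δ

  ⊢H-id : ∀ A → L ⊢H A ⇒ A
  ⊢H-id A = mp (mp (ax-S A (A ⇒ A) A) (ax-K A (A ⇒ A))) (ax-K A A)

  weaken : ∀ {H A B} → H ⊢ A → B ∷ H ⊢ A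
  weaken (hyp p)   = hyp (there p)
  weaken (thm t)   = thm t
  weaken (app f x) = app (weaken f) (weaken x)

  deduction : ∀ {H A B} → A ∷ H ⊢ B → H ⊢ A ⇒ B
  deduction (hyp (here refl)) = thm (⊢H-id _)
  deduction (hyp (there p))   = app (thm (ax-K _ _)) (hyp p)
  deduction (thm t)           = app (thm (ax-K _ _)) (thm t)
  deduction (app f x)         = app (app (thm (ax-S _ _ _)) (deduction f)) (deduction x)

  closed : ∀ {A} → [] ⊢ A → L ⊢H A
  closed (thm t)   = t
  closed (app f x) = mp (closed f) (closed x)

  ¬¬-elim : ∀ {H A} → H ⊢ ¬' (¬' A) → H ⊢ A
  ¬¬-elim = app (thm (ax-DN _))

  ex-falso : ∀ {H A} → H ⊢ ⊥' → H ⊢ A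
  ex-falso p = ¬¬-elim (app (thm (ax-K ⊥' _)) p)

  by-contradiction : ∀ {H A} → ¬' A ∷ H ⊢ ⊥' → H ⊢ A
  by-contradiction p = ¬¬-elim (deduction p)

  ∧-intro : ∀ {H A B} → H ⊢ A → H ⊢ B → H ⊢ A ∧' B
  ∧-intro p q = deduction (app (app (hyp (here refl)) (weaken p)) (weaken q))

  ∧-elimˡ : ∀ {H A B} → H ⊢ A ∧' B → H ⊢ A
  ∧-elimˡ c = by-contradiction
    (app (weaken c) (deduction (ex-falso (app (hyp (there (here refl))) (hyp (here refl))))))

  ∧-elimʳ : ∀ {H A B} → H ⊢ A ∧' B → H ⊢ B
  ∧-elimʳ c = by-contradiction (app (weaken c) (deduction (hyp (there (here refl)))))

  ¬∨-elimˡ : ∀ {H A B} → H ⊢ ¬' (A ∨' B) → H ⊢ ¬' A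
  ¬∨-elimˡ p = deduction
    (app (weaken p) (deduction (ex-falso (app (hyp (here refl)) (hyp (there (here refl)))))))

  ¬∨-elimʳ : ∀ {H A B} → H ⊢ ¬' (A ∨' B) → H ⊢ ¬' B
  ¬∨-elimʳ p = deduction (app (weaken p) (deduction (hyp (there (here refl)))))

  ⋀-elim : ∀ {H} Γ → H ⊢ ⋀ Γ → H ⊢⁺ Γ
  ⋀-elim []      _ = []
  ⋀-elim (_ ∷ Γ) p = ∧-elimˡ p ∷ ⋀-elim Γ (∧-elimʳ p)

  ¬⋁-elim : ∀ {H} Δ → H ⊢ ¬' (⋁ Δ) → H ⊢⁻ Δ
  ¬⋁-elim []      _ = []
  ¬⋁-elim (_ ∷ Δ) p = ¬∨-elimˡ p ∷ ¬⋁-elim Δ (¬∨-elimʳ p)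

  ≼-refl : ∀ {H A} → H ⊢ A ≼ A
  ≼-refl = thm (cpr (⊢H-id _))

  ≼-trans : ∀ {H A B C} → H ⊢ A ≼ B → H ⊢ B ≼ C → H ⊢ A ≼ C
  ≼-trans p q = app (thm (ax-tr _ _ _)) (∧-intro p q)

  ≼-∨ : ∀ {H A B C} → H ⊢ A ≼ B → H ⊢ A ≼ C → H ⊢ A ≼ (B ∨' C)
  ≼-∨ p q = app (thm (ax-or _ _ _)) (∧-intro p q)

  ≼-from-⊥ : ∀ {H A X} → H ⊢ ⊥' ≼ X → H ⊢ A ≼ X
  ≼-from-⊥ = ≼-trans (thm (cpr (closed (deduction (ex-falso (hyp (here refl)))))))

  ⊥≼-⋁ : ∀ {H Es} → All (λ E → H ⊢ ⊥' ≼ E) Es → H ⊢ ⊥' ≼ ⋁ Es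
  ⊥≼-⋁ []       = ≼-refl
  ⊥≼-⋁ (p ∷ ps) = ≼-∨ p (⊥≼-⋁ ps)

  -- A ≼ ⊤ by w and ⊤ ≼ B by cpr.
  true-≼ : ∀ {H A B} → T (has-w L) → H ⊢ A → H ⊢ A ≼ B
  true-≼ w a = ≼-trans (app (thm (ax-w w _)) a) (thm (cpr (mp (ax-K ⊤' _) (⊢H-id ⊥'))))

  ¬≼⇒¬ : ∀ {H A B C} → T (has-w L) → H ⊢ A ≼ C → H ⊢ ¬' (A ≼ B) → H ⊢ ¬' C
  ¬≼⇒¬ w a≼c n = deduction (app (weaken n) (≼-trans (weaken a≼c) (true-≼ w (hyp (here refl)))))

  ⊥≼¬-prefs : ∀ {H} → T (has-a L) → ∀ Γ → H ⊢⁺ Γ → All (λ A → H ⊢ ⊥' ≼ ¬' A) (prefs Γ)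
  ⊥≼¬-prefs a []             []       = []
  ⊥≼¬-prefs a (atom _ ∷ Γ)  (_ ∷ hs) = ⊥≼¬-prefs a Γ hs
  ⊥≼¬-prefs a (⊥' ∷ Γ)      (_ ∷ hs) = ⊥≼¬-prefs a Γ hs
  ⊥≼¬-prefs a (_ ⇒ _ ∷ Γ)   (_ ∷ hs) = ⊥≼¬-prefs a Γ hs
  ⊥≼¬-prefs a (A ≼ B ∷ Γ)   (h ∷ hs) = app (thm (ax-a- a A B)) h ∷ ⊥≼¬-prefs a Γ hs

  ⊥≼-prefs : ∀ {H} → T (has-a L) → ∀ Δ → H ⊢⁻ Δ → All (λ A → H ⊢ ⊥' ≼ A) (prefs Δ)
  ⊥≼-prefs a []             []       = []
  ⊥≼-prefs a (atom _ ∷ Δ)  (_ ∷ hs) = ⊥≼-prefs a Δ hs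
  ⊥≼-prefs a (⊥' ∷ Δ)      (_ ∷ hs) = ⊥≼-prefs a Δ hs
  ⊥≼-prefs a (_ ⇒ _ ∷ Δ)   (_ ∷ hs) = ⊥≼-prefs a Δ hs
  ⊥≼-prefs a (A ≼ B ∷ Δ)   (h ∷ hs) = app (thm (ax-a a A B)) h ∷ ⊥≼-prefs a Δ hs

  Σ≼-holds : ∀ {H Γ n} (C D : Fin n → Fm) → H ⊢⁺ Σ≼ C D ++ Γ → ∀ k → H ⊢ C k ≼ D k
  Σ≼-holds C D hs = tabulate⁻ (++⁻ˡ (Σ≼ C D) hs)

  sides≼ : List Fm → List Fm → ∀ {n} → (Fin n → Fm) → (Fin n → Fm) → Fm
  sides≼ Γ Δ C D = ⋁ (map ¬' (prefs Γ ++ Σ≼ C D) ++ prefs Δ)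

  ⊥≼-sides : ∀ {H n} → T (has-a L) → ∀ Γ Δ (C D : Fin n → Fm) →
             H ⊢⁺ Σ≼ C D ++ Γ → H ⊢⁻ Δ → H ⊢ ⊥' ≼ sides≼ Γ Δ C D
  ⊥≼-sides a Γ Δ C D hΓ hΔ = ⊥≼-⋁ (++⁺ (map⁺ (++⁺ left hΣ)) (⊥≼-prefs a Δ hΔ))
    where
    left = ⊥≼¬-prefs a Γ (++⁻ʳ (Σ≼ C D) hΓ)
    hΣ   = tabulate⁺ (λ k → app (thm (ax-a- a (C k) (D k))) (Σ≼-holds C D hΓ k))

  _⊩_ : List Fm → List Fm → Set
  Γ ⊩ Δ = ∀ {H} → H ⊢⁺ Γ → H ⊢⁻ Δ → H ⊢ ⊥'

  ⊩-↭ : ∀ {Γ Γ' Δ Δ'} → Γ' ↭ Γ → Δ' ↭ Δ → Γ ⊩ Δ → Γ' ⊩ Δ'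
  ⊩-↭ g d s hΓ hΔ = s (All-resp-↭ g hΓ) (All-resp-↭ d hΔ)

  ⊩-entails : ∀ {H Γ Δ A} → Γ ⊩ A ∷ Δ → H ⊢⁺ Γ → H ⊢⁻ Δ → H ⊢ A
  ⊩-entails s hΓ hΔ =
    by-contradiction (s (All.map weaken hΓ) (hyp (here refl) ∷ All.map weaken hΔ))

  ⊩-⇒ : ∀ {Y Z} → Y ∷ [] ⊩ Z ∷ [] → L ⊢H Y ⇒ Z
  ⊩-⇒ s = closed (deduction (⊩-entails s (hyp (here refl) ∷ []) []))

  ⊩-ax : ∀ {Γ Δ A} → A ∈ Γ → A ∈ Δ → Γ ⊩ Δ
  ⊩-ax a b hΓ hΔ = app (All.lookup hΔ b) (All.lookup hΓ a)

  ⊩-⊥ˡ : ∀ {Γ Δ} → ⊥' ∷ Γ ⊩ Δ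
  ⊩-⊥ˡ (h ∷ _) _ = h

  ⊩-weakenˡ : ∀ {Γ Δ A} → Γ ⊩ Δ → A ∷ Γ ⊩ Δ
  ⊩-weakenˡ s (_ ∷ hΓ) = s hΓ

  ⊩-weakenʳ : ∀ {Γ Δ A} → Γ ⊩ Δ → Γ ⊩ A ∷ Δ
  ⊩-weakenʳ s hΓ (_ ∷ hΔ) = s hΓ hΔ

  ⊩-⇒ˡ : ∀ {Γ Δ A B} → Γ ⊩ A ∷ Δ → B ∷ Γ ⊩ Δ → (A ⇒ B) ∷ Γ ⊩ Δ
  ⊩-⇒ˡ s₁ s₂ (f ∷ hΓ) hΔ = s₂ (app f (⊩-entails s₁ hΓ hΔ) ∷ hΓ) hΔ

  ⊩-⇒ʳ : ∀ {Γ Δ A B} → A ∷ Γ ⊩ B ∷ Δ → Γ ⊩ (A ⇒ B) ∷ Δ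
  ⊩-⇒ʳ s hΓ (h ∷ hΔ) =
    app h (deduction (⊩-entails s (hyp (here refl) ∷ All.map weaken hΓ) (All.map weaken hΔ)))

  ⊩-∨ʳ : ∀ {Γ Δ A B} → Γ ⊩ A ∷ B ∷ Δ → Γ ⊩ (A ∨' B) ∷ Δ
  ⊩-∨ʳ s hΓ (h ∷ hΔ) = s hΓ (¬∨-elimˡ h ∷ ¬∨-elimʳ h ∷ hΔ)

  ⊩-absorb : ∀ {Θ E} Ps Qs → Ps ++ Θ ⊩ Qs ++ E → Θ ⊩ ⋁ (map ¬' Ps ++ Qs) ∷ E
  ⊩-absorb Ps Qs s hΘ (h ∷ hE) =
    let h¬Ps , hQs = ++⁻ (map ¬' Ps) (¬⋁-elim (map ¬' Ps ++ Qs) h)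
    in s (++⁺ (All.map ¬¬-elim (map⁻ h¬Ps)) hΘ) (++⁺ hQs hE)

  ⊩-absorb-sides : ∀ Γ Δ {n} (C D : Fin n → Fm) Θ E →
                   prefs Γ ++ Σ≼ C D ++ Θ ⊩ E ++ prefs Δ → Θ ⊩ sides≼ Γ Δ C D ∷ E
  ⊩-absorb-sides Γ Δ C D Θ E s = ⊩-absorb (prefs Γ ++ Σ≼ C D) (prefs Δ)
    (⊩-↭ (↭-reflexive (++-assoc (prefs Γ) (Σ≼ C D) Θ)) (++-comm (prefs Δ) E) s)

  ≼-chain : ∀ {H} n (C D : Fin n → Fm) {A₀ A X} →
            H ⊢ A₀ ≼ A → (∀ k → H ⊢ C k ≼ D k) →
            (∀ k → C k ∷ [] ⊩ A ∷ below D k) → X ∷ [] ⊩ A ∷ allD D →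
            H ⊢ A₀ ≼ X
  ≼-chain ℕ.zero    C D a₀≼a _  _  x = ≼-trans a₀≼a (thm (cpr (⊩-⇒ x)))
  ≼-chain (ℕ.suc n) C D a₀≼a cd cs x =
    ≼-chain n (λ k → C (suc k)) (λ k → D (suc k)) (≼-∨ a₀≼a a₀≼D₀)
      (λ k → cd (suc k)) (λ k → ⊩-∨ʳ (cs (suc k))) (⊩-∨ʳ x)
    where
    a₀≼D₀ = ≼-trans (≼-trans a₀≼a (thm (cpr (⊩-⇒ (cs zero))))) (cd zero)

  ≼-chain-allD : ∀ {H n} (C D : Fin n → Fm) {A₀ A} →
                 H ⊢ A₀ ≼ A → (∀ k → H ⊢ C k ≼ D k) →
                 (∀ k → C k ∷ [] ⊩ A ∷ below D k) → ∀ j → H ⊢ A₀ ≼ D j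
  ≼-chain-allD C D a₀≼a cd cs j =
    ≼-chain _ C D a₀≼a cd cs (⊩-weakenʳ (⊩-ax (here refl) (∈-tabulate⁺ j)))

  cp-sound : ∀ {Γ Δ A B n} (C D : Fin n → Fm) →
             (∀ k → C k ∷ [] ⊩ A ∷ below D k) → B ∷ [] ⊩ A ∷ allD D →
             Σ≼ C D ++ Γ ⊩ (A ≼ B) ∷ Δ
  cp-sound C D cs b hΓ (h ∷ _) = app h (≼-chain _ C D ≼-refl (Σ≼-holds C D hΓ) cs b)

  n-sound : ∀ {Γ Δ n} → T (has-n L) → (C D : Fin n → Fm) →
            (∀ k → C k ∷ [] ⊩ below D k) → [] ⊩ allD D → Σ≼ C D ++ Γ ⊩ Δ
  n-sound nn C D cs e hΓ _ = app (thm (ax-n nn))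
    (≼-chain _ C D ≼-refl (Σ≼-holds C D hΓ) (λ k → ⊩-weakenʳ (cs k)) (⊩-weakenˡ (⊩-weakenʳ e)))

  t-sound : ∀ {Γ Δ n} → T (has-t L) → (C D : Fin n → Fm) →
            (∀ k → C k ∷ [] ⊩ below D k) → Σ≼ C D ++ Γ ⊩ allD D ++ Δ → Σ≼ C D ++ Γ ⊩ Δ
  t-sound t C D cs s hΓ hΔ = s hΓ (++⁺ (tabulate⁺ ¬D) hΔ)
    where
    ¬D = λ j → app (thm (ax-t t (D j)))
      (≼-chain-allD C D ≼-refl (Σ≼-holds C D hΓ) (λ k → ⊩-weakenʳ (cs k)) j)

  w-sound : ∀ {Γ Δ A B n} → T (has-w L) → (C D : Fin n → Fm) →
            (∀ k → C k ∷ [] ⊩ A ∷ below D k) →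
            Σ≼ C D ++ Γ ⊩ A ∷ (A ≼ B) ∷ allD D ++ Δ → Σ≼ C D ++ Γ ⊩ (A ≼ B) ∷ Δ
  w-sound w C D cs s hΓ (h ∷ hΔ) = s hΓ (¬≼⇒¬ w ≼-refl h ∷ h ∷ ++⁺ (tabulate⁺ ¬D) hΔ)
    where
    ¬D = λ j → ¬≼⇒¬ w (≼-chain-allD C D ≼-refl (Σ≼-holds C D hΓ) cs j) h

  w0-sound : ∀ {Γ Δ A B} → T (has-w L) → Γ ⊩ (A ≼ B) ∷ A ∷ Δ → Γ ⊩ (A ≼ B) ∷ Δ
  w0-sound w s hΓ (h ∷ hΔ) = s hΓ (h ∷ ¬≼⇒¬ w ≼-refl h ∷ hΔ)

  c0-sound : ∀ {Γ Δ A B} → T (has-w L) → T (has-c L) →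
             (A ≼ B) ∷ A ∷ Γ ⊩ Δ → (A ≼ B) ∷ Γ ⊩ B ∷ Δ → (A ≼ B) ∷ Γ ⊩ Δ
  c0-sound w c s₁ s₂ (h ∷ hΓ) hΔ = s₁ (h ∷ a ∷ hΓ) hΔ
    where
    b = ⊩-entails s₂ (h ∷ hΓ) hΔ
    a = app (thm (ax-c c _)) (≼-trans h (true-≼ w b))

  a-sound : ∀ {A B n} → T (has-a L) → ∀ Γ Δ (C D : Fin n → Fm) →
            (∀ k → prefs Γ ++ Σ≼ C D ++ C k ∷ [] ⊩ (A ≼ B) ∷ A ∷ below D k ++ prefs Δ) →
            prefs Γ ++ Σ≼ C D ++ B ∷ [] ⊩ (A ≼ B) ∷ A ∷ allD D ++ prefs Δ →
            Σ≼ C D ++ Γ ⊩ (A ≼ B) ∷ Δ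
  a-sound {A} {B} a Γ Δ C D cs b hΓ (h ∷ hΔ) =
    app h (≼-chain _ C D A≼A′ (Σ≼-holds C D hΓ) (λ k → absorb (cs k)) (absorb b))
    where
    -- ⊥ precedes every disjunct added to A (axioms a, a−), hence so does A.
    A′ = (sides≼ Γ Δ C D ∨' (A ≼ B)) ∨' A
    absorb : ∀ {Y E} → prefs Γ ++ Σ≼ C D ++ Y ∷ [] ⊩ (A ≼ B) ∷ A ∷ E ++ prefs Δ →
             Y ∷ [] ⊩ A′ ∷ E
    absorb s = ⊩-∨ʳ (⊩-∨ʳ (⊩-absorb-sides Γ Δ C D _ _ s))
    A≼A′ = ≼-∨ (≼-∨ (≼-from-⊥ (⊥≼-sides a Γ Δ C D hΓ hΔ)) (≼-from-⊥ (app (thm (ax-a a A B)) h)))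
               ≼-refl

  na-sound : ∀ {n} → T (has-a L) → T (has-n L) → ∀ Γ Δ (C D : Fin n → Fm) →
             (∀ k → prefs Γ ++ Σ≼ C D ++ C k ∷ [] ⊩ below D k ++ prefs Δ) →
             prefs Γ ++ Σ≼ C D ⊩ allD D ++ prefs Δ → Σ≼ C D ++ Γ ⊩ Δ
  na-sound a nn Γ Δ C D cs e hΓ hΔ = app (thm (ax-n nn))
    (≼-chain _ C D (⊥≼-sides a Γ Δ C D hΓ hΔ) (Σ≼-holds C D hΓ)
       (λ k → ⊩-absorb-sides Γ Δ C D _ _ (cs k)) (⊩-weakenˡ (⊩-absorb-sides Γ Δ C D [] _ e′)))
    where
    e′ = ⊩-↭ (↭-reflexive (cong (prefs Γ ++_) (++-identityʳ (Σ≼ C D)))) ↭-refl e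

  sound : ∀ {Γ Δ} → L ⊢G Γ ⟹ Δ → Γ ⊩ Δ
  sound (init _ _ _ g d) = ⊩-↭ g d (⊩-ax (here refl) (here refl))
  sound (⊥L _ g) = ⊩-↭ g ↭-refl ⊩-⊥ˡ
  sound (⇒L _ _ _ g s₁ s₂) = ⊩-↭ g ↭-refl (⊩-⇒ˡ (sound s₁) (sound s₂))
  sound (⇒R _ _ _ d s) = ⊩-↭ ↭-refl d (⊩-⇒ʳ (sound s))
  sound (CP _ _ _ _ _ _ C D g d cs b) =
    ⊩-↭ g d (cp-sound C D (λ k → sound (cs k)) (sound b))
  sound (Nn t _ _ C D _ g cs e) =
    ⊩-↭ g ↭-refl (n-sound (rule-N⇒has-n L t) C D (λ k → sound (cs k)) (sound e))
  sound (Tn t _ _ C D _ g cs s) =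
    ⊩-↭ g ↭-refl (t-sound (rule-T⇒has-t L t) C D (λ k → sound (cs k)) (sound s))
  sound (Wn t _ _ _ _ _ C D g d cs s) =
    ⊩-↭ g d (w-sound (rule-W⇒has-w L t) C D (λ k → sound (cs k)) (sound s))
  sound (W0 t _ _ _ d s) = ⊩-↭ ↭-refl d (w0-sound (rule-WC0⇒has-w L t) (sound s))
  sound (C0 t _ _ _ g s₁ s₂) =
    ⊩-↭ g ↭-refl (c0-sound (rule-WC0⇒has-w L t) (rule-WC0⇒has-c L t) (sound s₁) (sound s₂))
  sound (An t Γ Δ _ _ _ C D g d cs b) =
    ⊩-↭ g d (a-sound (rule-A⇒has-a L t) Γ Δ C D (λ k → sound (cs k)) (sound b))
  sound (NAn t Γ _ C D _ g cs e) =
    ⊩-↭ g ↭-refl (na-sound (rule-NA⇒has-a L t) (rule-NA⇒has-n L t) Γ _ C D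
                    (λ k → sound (cs k)) (sound e))

theorem4p1 : (L : Logic) (Γ Δ : List Fm) → L ⊢G Γ ⟹ Δ → L ⊢H ⋀ Γ ⇒ ⋁ Δ
theorem4p1 L Γ Δ d = closed (deduction (by-contradiction
  (sound d (⋀-elim Γ (hyp (there (here refl)))) (¬⋁-elim Δ (hyp (here refl))))))
  where open Derivations L
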